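{- If $n \geq m \geq 2$, then $\mathrm{sg_e}(K_{n,m}) \geq n$. Moreover, if $m=n$, then $\mathrm{sg_e}(K_{n,n}) \geq n+1$.
   Context: All graphs are finite and simple; $K_{n,m}$ is the complete bipartite graph with parts of sizes $n$ and $m$. For a graph $G$, a set $S\subseteq V(G)$ is a strong edge geodetic set if to each (unordered) pair of vertices $u,v\in S$ one can assign one shortest $u,v$-path (or no path) such that every edge of $G$ lies on at least one of the assigned paths. The strong edge geodetic number $\mathrm{sg_e}(G)$ is the minimum cardinality of a strong edge geodetic set of $G$. -}

module Defs where

open import Data.Nat using (ℕ; zero; suc; _+_; _≤_; _<_)
open import Data.Fin using (Fin; toℕ)
open import Data.Fin.Subset using (Subset; _∈_; ∣_∣)
open import Data.Maybe using (Maybe; just)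
open import Data.Product using (Σ; ∃; _×_; _,_)
open import Data.Sum using (_⊎_)
open import Relation.Nullary using (¬_)
open import Relation.Binary.PropositionalEquality using (_≡_)

record Graph : Set₁ where
  field
    N      : ℕ
    Adj    : Fin N → Fin N → Set
    sym    : ∀ x y → Adj x y → Adj y x
    irrefl : ∀ x → ¬ Adj x x

module _ (G : Graph) where
  open Graph G

  data Walk : Fin N → Fin N → Set where
    stop : ∀ x → Walk x x
    step : ∀ {x y z} → Adj x y → Walk y z → Walk x z

  len : ∀ {x y} → Walk x y → ℕ
  len (stop _)   = zero
  len (step _ w) = suc (len w)

  -- a shortest x,y-path: a walk of minimal length (such a walk is a path)
  IsShortest : ∀ {x y} → Walk x y → Set
  IsShortest {x} {y} w = ∀ (w' : Walk x y) → len w ≤ len w'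

  data EdgeOn (a b : Fin N) : ∀ {x y} → Walk x y → Set where
    here  : ∀ {x y z} (e : Adj x y) (w : Walk y z) →
            ((a ≡ x × b ≡ y) ⊎ (a ≡ y × b ≡ x)) → EdgeOn a b (step e w)
    there : ∀ {x y z} (e : Adj x y) (w : Walk y z) →
            EdgeOn a b w → EdgeOn a b (step e w)

  -- S is a strong edge geodetic set: to each unordered pair {u,v} ⊆ S
  -- (represented by toℕ u < toℕ v) one assigns a shortest u,v-path or
  -- nothing, and every edge lies on some assigned path.
  IsStrongEdgeGeodetic : Subset N → Set
  IsStrongEdgeGeodetic S =
    Σ ((u v : Fin N) → Maybe (Walk u v)) λ assign →
      (∀ u v (w : Walk u v) → assign u v ≡ just w →
         u ∈ S × v ∈ S × toℕ u < toℕ v × IsShortest w)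
      × (∀ a b → Adj a b →
           ∃ λ u → ∃ λ v → Σ (Walk u v) λ w → assign u v ≡ just w × EdgeOn a b w)

  -- sg_e(G) ≥ k : every strong edge geodetic set has at least k vertices
  -- (equivalently the minimum cardinality is ≥ k)
  sgeAtLeast : ℕ → Set
  sgeAtLeast k = ∀ (S : Subset N) → IsStrongEdgeGeodetic S → k ≤ ∣ S ∣

-- K_{n,m}: vertices Fin (n + m); part A = {i | i < n}, part B = {i | n ≤ i}.
KAdj : (n m : ℕ) → Fin (n + m) → Fin (n + m) → Set
KAdj n m x y = (toℕ x < n × n ≤ toℕ y) ⊎ (n ≤ toℕ x × toℕ y < n)

open import Data.Sum using (inj₁; inj₂)
open import Data.Product using (proj₁; proj₂)
open import Data.Nat.Properties using (<⇒≱)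

K : ℕ → ℕ → Graph
K n m = record
  { N = n + m
  ; Adj = KAdj n m
  ; sym = λ { x y (inj₁ (p , q)) → inj₂ (q , p) ; x y (inj₂ (p , q)) → inj₁ (q , p) }
  ; irrefl = λ { x (inj₁ (p , q)) → <⇒≱ p q ; x (inj₂ (p , q)) → <⇒≱ q p }
  }

-- In a graph of diameter at most 2 every assigned shortest path has length at
-- most 2, so an edge x y with x outside the strong edge geodetic set S can only
-- be covered by a path y – x – z with y, z ∈ S.  Hence all neighbours of x lie
-- in S, and for a fixed y the vertex x is recovered from z as the middle vertex
-- of the path assigned to {y, z}: x ↦ z is injective.  Let A be the n-part and
-- B the m-part of K_{n,m}.  If some vertex of A is outside S then B ⊆ S, and
-- for y ∈ B the vertices outside S inject into B ∖ {y}, so |S| ≥ n + 1.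
-- Otherwise A ⊆ S, so |S| ≥ n, and for y ∈ A the vertices outside S inject
-- into A ∖ {y}, so |S| ≥ m + 1.
module Submission where

open import Defs
open import Data.Nat using (ℕ; suc; _≤_)
open import Data.Product using (_×_)
open import Relation.Binary.PropositionalEquality using (_≡_)

open import Data.Nat using (zero; _+_; _∸_; _<_; _⊓_; z≤n; s≤s; _≤?_; _<?_)
open import Data.Nat.Properties
  using ( ≤-trans; ≤-refl; n≤1+n; <-irrefl; <-asym; <⇒≱; ≤∧≢⇒<; ≮⇒≥; ≰⇒>; n≢0⇒n>0
        ; m≤m+n; m<m+n; m<n+m; +-monoˡ-≤; +-monoˡ-<; +-cancelʳ-≡
        ; ∸-monoˡ-<; ∸-monoʳ-<; ∸-cancelʳ-≡; m⊓n≤m; m⊓n≤n; ⊓-idem )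
open import Data.Fin using (Fin; toℕ; fromℕ<; zero; suc)
open import Data.Fin.Properties using (toℕ<n; toℕ-fromℕ<; toℕ-injective; injective⇒≤; any?)
  renaming (suc-injective to Fin-suc-injective)
open import Data.Fin.Subset using (Subset; _∈_; _∉_; ∣_∣; ∁; inside; outside)
open import Data.Fin.Subset.Properties using (_∈?_; ∣∁p∣≡n∸∣p∣; x∈∁p⇒x∉p)
open import Data.Vec.Base using (_∷_; here; there)
open import Data.Maybe using (Maybe; just)
import Data.Maybe as Maybe
open import Data.Maybe.Properties using (just-injective)
open import Data.Product using (Σ; _,_; proj₁; proj₂)
open import Data.Sum using (_⊎_; inj₁; inj₂)
open import Relation.Nullary using (yes; no; ¬?; _×-dec_; contradiction)
open import Relation.Nullary.Decidable using (decidable-stable)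
open import Relation.Binary.PropositionalEquality
  using (_≢_; refl; sym; trans; cong; subst)

enumerate : ∀ {N} (P : Subset N) → Fin ∣ P ∣ → Fin N
enumerate (inside  ∷ P) zero    = zero
enumerate (inside  ∷ P) (suc j) = suc (enumerate P j)
enumerate (outside ∷ P) j       = suc (enumerate P j)

enumerate-∈ : ∀ {N} (P : Subset N) (j : Fin ∣ P ∣) → enumerate P j ∈ P
enumerate-∈ (inside  ∷ P) zero    = here
enumerate-∈ (inside  ∷ P) (suc j) = there (enumerate-∈ P j)
enumerate-∈ (outside ∷ P) j       = there (enumerate-∈ P j)

enumerate-injective : ∀ {N} (P : Subset N) {i j : Fin ∣ P ∣} →
                      enumerate P i ≡ enumerate P j → i ≡ j
enumerate-injective (inside  ∷ P) {zero}  {zero}  _  = refl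
enumerate-injective (inside  ∷ P) {suc i} {suc j} eq =
  cong suc (enumerate-injective P (Fin-suc-injective eq))
enumerate-injective (outside ∷ P)                 eq =
  enumerate-injective P (Fin-suc-injective eq)

∣p∣≤-injection : ∀ {N k} (P : Subset N) (f : ∀ x → x ∈ P → Fin k) →
                 (∀ {x y} p q → f x p ≡ f y q → x ≡ y) → ∣ P ∣ ≤ k
∣p∣≤-injection P f f-injective =
  injective⇒≤ {f = λ j → f (enumerate P j) (enumerate-∈ P j)} λ eq →
    enumerate-injective P (f-injective (enumerate-∈ P _) (enumerate-∈ P _) eq)

∸-cancelˡ-≥ : ∀ {m n o} → n ≤ m → m ∸ o ≤ m ∸ n → n ≤ o
∸-cancelˡ-≥ {n = n} {o} n≤m m∸o≤m∸n with n ≤? o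
... | yes n≤o = n≤o
... | no  n≰o = contradiction m∸o≤m∸n (<⇒≱ (∸-monoʳ-< (≰⇒> n≰o) n≤m))

≤∣p∣-from-∁-injection : ∀ {N k} (S : Subset N) → k ≤ N → (f : ∀ x → x ∉ S → ℕ) →
                        (∀ x p → k ≤ f x p) → (∀ x p → f x p < N) →
                        (∀ {x y} p q → f x p ≡ f y q → x ≡ y) → k ≤ ∣ S ∣
≤∣p∣-from-∁-injection {N} {k} S k≤N f k≤f f<N f-injective =
  ∸-cancelˡ-≥ k≤N (subst (_≤ N ∸ k) (∣∁p∣≡n∸∣p∣ S) (∣p∣≤-injection (∁ S) code code-injective))
  where
  code : ∀ x → x ∈ ∁ S → Fin (N ∸ k)
  code x p = fromℕ< (∸-monoˡ-< (f<N x (x∈∁p⇒x∉p p)) (k≤f x (x∈∁p⇒x∉p p)))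

  code-injective : ∀ {x y} p q → code x p ≡ code y q → x ≡ y
  code-injective {x} {y} p q eq = f-injective _ _ (∸-cancelʳ-≡ (k≤f x _) (k≤f y _) (begin
    f x _ ∸ k      ≡⟨ sym (toℕ-fromℕ< _) ⟩
    toℕ (code x p) ≡⟨ cong toℕ eq ⟩
    toℕ (code y q) ≡⟨ toℕ-fromℕ< _ ⟩
    f y _ ∸ k      ∎))
    where open Relation.Binary.PropositionalEquality.≡-Reasoning

module _ (G : Graph) where
  open Graph G using (N; Adj)

  second : ∀ {u v} → Walk G u v → Fin N
  second (stop u)           = u
  second (step {y = y} _ _) = y

  edgeOn-walk≤2 : ∀ {u v x y} (w : Walk G u v) → len G w ≤ 2 → x ≢ u → x ≢ v →
                  EdgeOn G x y w →
                  second w ≡ x × ((y ≡ u × Adj x v) ⊎ (y ≡ v × Adj x u))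
  edgeOn-walk≤2 (step _ (stop _)) _ x≢u x≢v (here _ _ (inj₁ (x≡u , _))) = contradiction x≡u x≢u
  edgeOn-walk≤2 (step _ (stop _)) _ x≢u x≢v (here _ _ (inj₂ (x≡v , _))) = contradiction x≡v x≢v
  edgeOn-walk≤2 (step _ (step _ (stop _))) _ x≢u x≢v (here _ _ (inj₁ (x≡u , _))) =
    contradiction x≡u x≢u
  edgeOn-walk≤2 (step _ (step e (stop _))) _ x≢u x≢v (here _ _ (inj₂ (refl , refl))) =
    refl , inj₁ (refl , e)
  edgeOn-walk≤2 (step e (step _ (stop _))) _ x≢u x≢v (there _ _ (here _ _ (inj₁ (refl , refl)))) =
    refl , inj₂ (refl , Graph.sym G _ _ e)
  edgeOn-walk≤2 (step _ (step _ (stop _))) _ x≢u x≢v (there _ _ (here _ _ (inj₂ (x≡v , _)))) =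
    contradiction x≡v x≢v
  edgeOn-walk≤2 (step _ (step _ (step _ _))) (s≤s (s≤s ())) _ _ _

module Diameter≤2
  (G : Graph) (diameter≤2 : ∀ u v → Σ (Walk G u v) λ w → len G w ≤ 2)
  {S : Subset (Graph.N G)} (geodetic : IsStrongEdgeGeodetic G S)
  where
  open Graph G using (N; Adj)

  private
    assign : (u v : Fin N) → Maybe (Walk G u v)
    assign = proj₁ geodetic

    assigned-valid : ∀ u v (w : Walk G u v) → assign u v ≡ just w →
                     u ∈ S × v ∈ S × toℕ u < toℕ v × IsShortest G w
    assigned-valid = proj₁ (proj₂ geodetic)

    covers : ∀ a b → Adj a b →
             Σ (Fin N) λ u → Σ (Fin N) λ v → Σ (Walk G u v) λ w → assign u v ≡ just w × EdgeOn G a b w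
    covers = proj₂ (proj₂ geodetic)

  via : Fin N → Fin N → Maybe (Fin N)
  via y z with toℕ y <? toℕ z
  ... | yes _ = Maybe.map (second G) (assign y z)
  ... | no  _ = Maybe.map (second G) (assign z y)

  via-assigned : ∀ {u v} {w : Walk G u v} → assign u v ≡ just w →
                 via u v ≡ just (second G w) × via v u ≡ just (second G w)
  via-assigned {u} {v} {w} assigned = forwards , backwards
    where
    u<v : toℕ u < toℕ v
    u<v = proj₁ (proj₂ (proj₂ (assigned-valid u v w assigned)))

    forwards : via u v ≡ just (second G w)
    forwards with toℕ u <? toℕ v
    ... | yes _   rewrite assigned = refl
    ... | no  u≮v = contradiction u<v u≮v

    backwards : via v u ≡ just (second G w)
    backwards with toℕ v <? toℕ u
    ... | yes v<u = contradiction v<u (<-asym u<v)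
    ... | no  _   rewrite assigned = refl

  record Detour (x y : Fin N) : Set where
    field
      partner     : Fin N
      partner-adj : Adj x partner
      partner≢    : partner ≢ y
      via-partner : via y partner ≡ just x
  open Detour public

  private
    covering : ∀ {x y} → x ∉ S → Adj x y → y ∈ S × Detour x y
    covering {x} {y} x∉S xy with covers x y xy
    ... | u , v , w , assigned , on with assigned-valid u v w assigned
    ... | u∈S , v∈S , u<v , shortest
          with edgeOn-walk≤2 G w w≤2 (λ { refl → x∉S u∈S }) (λ { refl → x∉S v∈S }) on
      where
      w≤2 : len G w ≤ 2
      w≤2 = ≤-trans (shortest (proj₁ (diameter≤2 u v))) (proj₂ (diameter≤2 u v))
    ... | refl , inj₁ (refl , xv) =
      u∈S , record { partner = v ; partner-adj = xv
                   ; partner≢ = λ v≡u → <-irrefl (cong toℕ (sym v≡u)) u<v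
                   ; via-partner = proj₁ (via-assigned assigned) }
    ... | refl , inj₂ (refl , xu) =
      v∈S , record { partner = u ; partner-adj = xu
                   ; partner≢ = λ u≡v → <-irrefl (cong toℕ u≡v) u<v
                   ; via-partner = proj₂ (via-assigned assigned) }

  neighbour∈S : ∀ {x y} → x ∉ S → Adj x y → y ∈ S
  neighbour∈S x∉S xy = proj₁ (covering x∉S xy)

  detour : ∀ {x y} → x ∉ S → Adj x y → Detour x y
  detour x∉S xy = proj₂ (covering x∉S xy)

  detour-injective : ∀ {x x′ y} (d : Detour x y) (d′ : Detour x′ y) →
                     partner d ≡ partner d′ → x ≡ x′
  detour-injective d d′ refl = just-injective (trans (sym (via-partner d)) (via-partner d′))

module _ {n m : ℕ} where

  a₀ : 1 ≤ n → Fin (n + m)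
  a₀ 1≤n = fromℕ< (≤-trans 1≤n (m≤m+n n m))

  b₀ : 1 ≤ m → Fin (n + m)
  b₀ 1≤m = fromℕ< (m<m+n n 1≤m)

  a₀-index : (1≤n : 1 ≤ n) → toℕ (a₀ 1≤n) ≡ 0
  a₀-index 1≤n = toℕ-fromℕ< _

  b₀-index : (1≤m : 1 ≤ m) → toℕ (b₀ 1≤m) ≡ n
  b₀-index 1≤m = toℕ-fromℕ< _

  a₀-in-A : (1≤n : 1 ≤ n) → toℕ (a₀ 1≤n) < n
  a₀-in-A 1≤n = subst (_< n) (sym (a₀-index 1≤n)) 1≤n

  b₀-in-B : (1≤m : 1 ≤ m) → n ≤ toℕ (b₀ 1≤m)
  b₀-in-B 1≤m = subst (n ≤_) (sym (b₀-index 1≤m)) ≤-refl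

  K-diameter≤2 : 1 ≤ n → 1 ≤ m →
                 ∀ u v → Σ (Walk (K n m) u v) λ w → len (K n m) w ≤ 2
  K-diameter≤2 1≤n 1≤m u v with toℕ u <? n | toℕ v <? n
  ... | yes u∈A | yes v∈A =
    step (inj₁ (u∈A , b₀-in-B 1≤m)) (step (inj₂ (b₀-in-B 1≤m , v∈A)) (stop v)) , ≤-refl
  ... | yes u∈A | no  v∉A = step (inj₁ (u∈A , ≮⇒≥ v∉A)) (stop v) , s≤s z≤n
  ... | no  u∉A | yes v∈A = step (inj₂ (≮⇒≥ u∉A , v∈A)) (stop v) , s≤s z≤n
  ... | no  u∉A | no  v∉A =
    step (inj₂ (≮⇒≥ u∉A , a₀-in-A 1≤n)) (step (inj₁ (a₀-in-A 1≤n , ≮⇒≥ v∉A)) (stop v)) , ≤-refl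

  K-adj-from-A : ∀ {x z} → toℕ x < n → KAdj n m x z → n ≤ toℕ z
  K-adj-from-A _   (inj₁ (_ , n≤z)) = n≤z
  K-adj-from-A x<n (inj₂ (n≤x , _)) = contradiction n≤x (<⇒≱ x<n)

  K-adj-from-B : ∀ {x z} → n ≤ toℕ x → KAdj n m x z → toℕ z < n
  K-adj-from-B n≤x (inj₁ (x<n , _)) = contradiction n≤x (<⇒≱ x<n)
  K-adj-from-B _   (inj₂ (_ , z<n)) = z<n

module _ {n m : ℕ} (1≤n : 1 ≤ n) (1≤m : 1 ≤ m)
         {S : Subset (n + m)} (geodetic : IsStrongEdgeGeodetic (K n m) S) where
  open Diameter≤2 (K n m) (K-diameter≤2 1≤n 1≤m) geodetic

  A⊈S⇒n<∣S∣ : ∀ a → toℕ a < n → a ∉ S → suc n ≤ ∣ S ∣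
  A⊈S⇒n<∣S∣ a a<n a∉S =
    ≤∣p∣-from-∁-injection S (m<m+n n 1≤m) (λ x x∉S → toℕ (partner (d x∉S)))
      (λ x x∉S → ≤∧≢⇒< (n≤partner x∉S) (partner≢n x∉S)) (λ _ _ → toℕ<n _)
      (λ x∉S y∉S eq → detour-injective (d x∉S) (d y∉S) (toℕ-injective eq))
    where
    outsider∈A : ∀ {x} → x ∉ S → toℕ x < n
    outsider∈A {x} x∉S with toℕ x <? n
    ... | yes x<n = x<n
    ... | no  x≮n = contradiction (neighbour∈S a∉S (inj₁ (a<n , ≮⇒≥ x≮n))) x∉S

    d : ∀ {x} → x ∉ S → Detour x (b₀ 1≤m)
    d x∉S = detour x∉S (inj₁ (outsider∈A x∉S , b₀-in-B 1≤m))

    n≤partner : ∀ {x} (x∉S : x ∉ S) → n ≤ toℕ (partner (d x∉S))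
    n≤partner x∉S = K-adj-from-A (outsider∈A x∉S) (partner-adj (d x∉S))

    partner≢n : ∀ {x} (x∉S : x ∉ S) → n ≢ toℕ (partner (d x∉S))
    partner≢n x∉S n≡p =
      partner≢ (d x∉S) (toℕ-injective (trans (sym n≡p) (sym (b₀-index 1≤m))))

  A⊆S⇒n≤∣S∣×m<∣S∣ : (∀ a → toℕ a < n → a ∈ S) → n ≤ ∣ S ∣ × suc m ≤ ∣ S ∣
  A⊆S⇒n≤∣S∣×m<∣S∣ A⊆S =
    ≤∣p∣-from-∁-injection S (m≤m+n n m) (λ x _ → toℕ x)
      (λ _ → outsider∈B) (λ x _ → toℕ<n x) (λ _ _ → toℕ-injective) ,
    -- partners lie in A ∖ {a₀}; shifting by m places their indices in [1 + m, n + m)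
    ≤∣p∣-from-∁-injection S (m<n+m m 1≤n) (λ x x∉S → toℕ (partner (d x∉S)) + m)
      (λ x x∉S → +-monoˡ-≤ m (1≤partner x∉S))
      (λ x x∉S → +-monoˡ-< m (K-adj-from-B (outsider∈B x∉S) (partner-adj (d x∉S))))
      (λ x∉S y∉S eq → detour-injective (d x∉S) (d y∉S)
                        (toℕ-injective (+-cancelʳ-≡ _ _ _ eq)))
    where
    outsider∈B : ∀ {x} → x ∉ S → n ≤ toℕ x
    outsider∈B {x} x∉S with toℕ x <? n
    ... | yes x<n = contradiction (A⊆S x x<n) x∉S
    ... | no  x≮n = ≮⇒≥ x≮n

    d : ∀ {x} → x ∉ S → Detour x (a₀ 1≤n)
    d x∉S = detour x∉S (inj₂ (outsider∈B x∉S , a₀-in-A 1≤n))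

    1≤partner : ∀ {x} (x∉S : x ∉ S) → 1 ≤ toℕ (partner (d x∉S))
    1≤partner x∉S = n≢0⇒n>0 λ p≡0 →
      partner≢ (d x∉S) (toℕ-injective (trans p≡0 (sym (a₀-index 1≤n))))

  K-geodetic-bound : n ≤ ∣ S ∣ × n ⊓ m < ∣ S ∣
  K-geodetic-bound with any? (λ a → (toℕ a <? n) ×-dec ¬? (a ∈? S))
  ... | yes (a , a<n , a∉S) = let n<S = A⊈S⇒n<∣S∣ a a<n a∉S in
    ≤-trans (n≤1+n n) n<S , ≤-trans (s≤s (m⊓n≤m n m)) n<S
  ... | no ∄A-outsider = n≤S , ≤-trans (s≤s (m⊓n≤n n m)) m<S
    where
    A⊆S : ∀ a → toℕ a < n → a ∈ S
    A⊆S a a<n = decidable-stable (a ∈? S) λ a∉S → ∄A-outsider (a , a<n , a∉S)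
    n≤S : n ≤ ∣ S ∣
    n≤S = proj₁ (A⊆S⇒n≤∣S∣×m<∣S∣ A⊆S)
    m<S : suc m ≤ ∣ S ∣
    m<S = proj₂ (A⊆S⇒n≤∣S∣×m<∣S∣ A⊆S)

K-sge≥ : ∀ {n m} → 1 ≤ n → 1 ≤ m → sgeAtLeast (K n m) n × sgeAtLeast (K n m) (suc (n ⊓ m))
K-sge≥ 1≤n 1≤m = (λ S geodetic → proj₁ (K-geodetic-bound 1≤n 1≤m geodetic))
               , (λ S geodetic → proj₂ (K-geodetic-bound 1≤n 1≤m geodetic))

corollary2p4 : ∀ (n m : ℕ) → 2 ≤ m → m ≤ n →
    sgeAtLeast (K n m) n × (m ≡ n → sgeAtLeast (K n m) (suc n))
corollary2p4 n m 2≤m m≤n =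
  proj₁ (K-sge≥ 1≤n 1≤m) ,
  λ { refl → subst (λ k → sgeAtLeast (K m m) (suc k)) (⊓-idem m) (proj₂ (K-sge≥ 1≤n 1≤m)) }
  where
  1≤m : 1 ≤ m
  1≤m = ≤-trans (n≤1+n 1) 2≤m
  1≤n : 1 ≤ n
  1≤n = ≤-trans 1≤m m≤n
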